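{- Let $P,Q$ be finite ordered sets and $0<k<l$. Suppose $P_{k\uparrow}\cap P_{l\downarrow}$ and $Q_{k\uparrow}\cap Q_{l\downarrow}$ are rigid separators; there is an isomorphism $\phi:P\setminus\{M_P\}\to Q\setminus\{M_Q\}$ with $\mathrm{rank}_Q(\phi(x))=\mathrm{rank}_P(x)$ for all $x$, where $M_P$ and $M_Q$ are maximal elements of rank $r>l$ in $P$ and $Q$ respectively; and there is an isomorphism $\psi:P\setminus\{m_P\}\to Q\setminus\{m_Q\}$ with $\mathrm{rank}_Q(\psi(x))=\mathrm{rank}_P(x)$ for all $x$, where $m_P,m_Q$ are minimal elements of $P$ and $Q$ respectively. Then $P$ is isomorphic to $Q$.
   Context: Rank of $x$: length (number of elements minus one) of the longest chain from a minimal element up to $x$. $P_{k\uparrow}=\{x\in P:\mathrm{rank}(x)\ge k\}$, $P_{l\downarrow}=\{x\in P:\mathrm{rank}(x)\le l\}$, with induced orders. For $0<k<l$, $P_{k\uparrow}\cap P_{l\downarrow}$ is a rigid separator if it is rigid (its only automorphism is the identity), $P$ has elements of rank $>l$, and no element of rank $<k$ is a lower cover of an element of rank $>l$. Ranks in $P\setminus\{M_P\}$ etc. refer to ranks in the original sets. -}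

module Defs where

open import Level using (0ℓ)
open import Data.Nat using (ℕ; zero; suc) renaming (_≤_ to _≤ℕ_; _<_ to _<ℕ_)
open import Data.Fin using (Fin)
open import Data.Product using (Σ; ∃; _×_; _,_; proj₁; proj₂)
open import Data.Unit using (⊤)
open import Data.Empty using (⊥)
open import Relation.Nullary using (¬_)
open import Relation.Binary.PropositionalEquality using (_≡_)
open import Relation.Binary.Definitions using (Decidable)
open import Relation.Binary.Structures using (IsPartialOrder)
open import Function.Bundles using (_⇔_)

record FinPoset : Set₁ where
  field
    card  : ℕ
    _≤_   : Fin card → Fin card → Set
    isPO  : IsPartialOrder _≡_ _≤_
    _≤?_  : Decidable _≤_

  Elt : Set
  Elt = Fin card

  _<_ : Elt → Elt → Set
  x < y = (x ≤ y) × ¬ (x ≡ y)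

  Minimal : Elt → Set
  Minimal x = ∀ y → y ≤ x → y ≡ x

  Maximal : Elt → Set
  Maximal x = ∀ y → x ≤ y → y ≡ x

  _⋖_ : Elt → Elt → Set
  x ⋖ y = (x < y) × (∀ z → x < z → z < y → ⊥)

  data ChainTo : Elt → ℕ → Set where
    start : ∀ {x} → Minimal x → ChainTo x 0
    step  : ∀ {x y r} → ChainTo x r → x < y → ChainTo y (suc r)

  Rank : Elt → ℕ → Set
  Rank x r = ChainTo x r × (∀ s → ChainTo x s → s ≤ℕ r)

  RankGe : ℕ → Elt → Set
  RankGe k x = ∃ λ r → Rank x r × k ≤ℕ r

  RankLe : ℕ → Elt → Set
  RankLe l x = ∃ λ r → Rank x r × r ≤ℕ l

  RankLt : ℕ → Elt → Set
  RankLt k x = ∃ λ r → Rank x r × r <ℕ k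

  RankGt : ℕ → Elt → Set
  RankGt l x = ∃ λ r → Rank x r × l <ℕ r

  Band : ℕ → ℕ → Elt → Set
  Band k l x = RankGe k x × RankLe l x

open FinPoset public using (Elt)

record SubIso (P : FinPoset) (S : Elt P → Set) (Q : FinPoset) (T : Elt Q → Set) : Set where
  private
    module P = FinPoset P
    module Q = FinPoset Q
  field
    to      : Σ (Elt P) S → Σ (Elt Q) T
    from    : Σ (Elt Q) T → Σ (Elt P) S
    from-to : ∀ a → proj₁ (from (to a)) ≡ proj₁ a
    to-from : ∀ b → proj₁ (to (from b)) ≡ proj₁ b
    mono    : ∀ a b → (proj₁ a P.≤ proj₁ b) ⇔ (proj₁ (to a) Q.≤ proj₁ (to b))

_≅_ : FinPoset → FinPoset → Set
P ≅ Q = SubIso P (λ _ → ⊤) Q (λ _ → ⊤)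

Rigid : (P : FinPoset) → (Elt P → Set) → Set
Rigid P S = (f : SubIso P S P S) → ∀ a → proj₁ (SubIso.to f a) ≡ proj₁ a

RigidSeparator : FinPoset → ℕ → ℕ → Set
RigidSeparator P k l =
  Rigid P (Band k l)
  × (∃ λ x → RankGt l x)
  × (∀ x y → RankLt k x → RankGt l y → x ⋖ y → ⊥)
  where open FinPoset P

Without : (P : FinPoset) → Elt P → Elt P → Set
Without P z x = ¬ (x ≡ z)

-- an isomorphism of subposets that preserves ranks (computed in the original posets)
RankPresIso : (P : FinPoset) (S : Elt P → Set) (Q : FinPoset) (T : Elt Q → Set)
            → SubIso P S Q T → Set
RankPresIso P S Q T φ =
  ∀ a r → FinPoset.Rank P (proj₁ a) r → FinPoset.Rank Q (proj₁ (SubIso.to φ a)) r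

{-# OPTIONS --safe #-}
module Submission where

-- φ and ψ both restrict to rank-preserving isomorphisms between the bands
-- P_{k↑} ∩ P_{l↓} and Q_{k↑} ∩ Q_{l↓}; as the band of P is rigid, they coincide there.
-- Hence φ on ranks ≤ l (avoiding M_P, of rank r > l) and ψ on ranks ≥ k (avoiding m_P,
-- of rank 0 < k) glue to a map P → Q, and φ⁻¹, ψ⁻¹ glue to its inverse. The glued maps
-- are monotone: a relation x ≤ y with rank x < k and rank y > l is not a covering, so
-- refining it through covers reaches an element of the band between x and y.

open import Defs
open import Data.Empty using (⊥; ⊥-elim)
open import Data.Fin.Induction using (po-wellFounded; po-noetherian)
open import Data.Fin.Properties using (any?; all?; _≟_; pigeonhole)
open import Data.Nat using (ℕ; zero; suc; _≤_; _<_; _≤?_; s≤s; s≤s⁻¹)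
open import Data.Nat.Properties
  using (≤-refl; ≤-trans; ≤-antisym; <⇒≤; <⇒≱; ≰⇒>; ≤∧≢⇒<; n≤0⇒n≡0)
open import Data.Product using (Σ; ∃; _×_; _,_; proj₁; proj₂)
open import Data.Unit using (tt)
open import Data.Vec using (Vec; []; _∷_; lookup)
open import Data.Vec.Relation.Unary.Linked using (Linked; [-]; _∷_)
open import Data.Vec.Relation.Unary.Linked.Properties using (lookup⁺)
open import Function.Base using (flip; _∘_)
open import Function.Bundles using (Equivalence; mk⇔)
open import Induction.WellFounded using (Acc; acc; WellFounded)
open import Relation.Binary.Construct.NonStrictToStrict using (<-isStrictPartialOrder)
open import Relation.Binary.Definitions using (Decidable)
open import Relation.Binary.PropositionalEquality
  using (_≡_; refl; sym; trans; cong; subst; subst₂; module ≡-Reasoning)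
open import Relation.Binary.Structures using (IsPartialOrder; IsStrictPartialOrder)
open import Relation.Nullary using (Dec; yes; no; contradiction)
open import Relation.Nullary.Decidable using (_×-dec_; _→-dec_; ¬?; map′; decidable-stable)
open import Relation.Unary using (Pred)

open SubIso
open ≡-Reasoning

∃-greatest : ∀ {p} {P : Pred ℕ p} → (∀ n → Dec (P n)) → ∀ n → (∀ m → P m → m ≤ n)
  → ∃ P → ∃ λ r → P r × (∀ m → P m → m ≤ r)
∃-greatest P? n bounded witness with P? n
... | yes Pn = n , Pn , bounded
∃-greatest {P = P} P? zero bounded (m , Pm) | no ¬P0 =
  contradiction (subst P (n≤0⇒n≡0 (bounded m Pm)) Pm) ¬P0
∃-greatest {P = P} P? (suc n) bounded witness | no ¬Pn = ∃-greatest P? n bounded′ witness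
  where
  bounded′ : ∀ m → P m → m ≤ n
  bounded′ m Pm = s≤s⁻¹ (≤∧≢⇒< (bounded m Pm) λ { refl → ¬Pn Pm })

module Ranks (P : FinPoset) where
  open FinPoset P hiding (Elt) renaming (_≤_ to _⊑_; _<_ to _⊏_; _≤?_ to _⊑?_)
  open IsPartialOrder isPO using () renaming (refl to ⊑-refl; trans to ⊑-trans)
  open IsStrictPartialOrder (<-isStrictPartialOrder _≡_ _⊑_ isPO)
    using () renaming (irrefl to ⊏-irrefl; trans to ⊏-trans)

  _⊏?_ : Decidable _⊏_
  x ⊏? y = x ⊑? y ×-dec ¬? (x ≟ y)

  ⊏-wellFounded : WellFounded _⊏_
  ⊏-wellFounded = po-wellFounded isPO

  ⊏-noetherian : WellFounded (flip _⊏_)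
  ⊏-noetherian = po-noetherian isPO

  ∃-cover-below : ∀ {x y} → x ⊏ y → ∃ λ c → x ⋖ c × c ⊑ y
  ∃-cover-below {y = y} = go (⊏-wellFounded y)
    where
    go : ∀ {x y} → Acc _⊏_ y → x ⊏ y → ∃ λ c → x ⋖ c × c ⊑ y
    go {x} {y} (acc rs) x⊏y with any? (λ w → x ⊏? w ×-dec w ⊏? y)
    ... | yes (w , x⊏w , w⊏y) =
      let c , x⋖c , c⊑w = go (rs w⊏y) x⊏w in c , x⋖c , ⊑-trans c⊑w (proj₁ w⊏y)
    ... | no ∄w = y , (x⊏y , λ w x⊏w w⊏y → ∄w (w , x⊏w , w⊏y)) , ⊑-refl

  Minimal? : ∀ x → Dec (Minimal x)
  Minimal? x = all? λ y → y ⊑? x →-dec y ≟ x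

  ChainTo? : ∀ s x → Dec (ChainTo x s)
  ChainTo? zero x = map′ start (λ { (start m) → m }) (Minimal? x)
  ChainTo? (suc s) x =
    map′ (λ (_ , c , y⊏x) → step c y⊏x) (λ { (step c y⊏x) → _ , c , y⊏x })
         (any? λ y → ChainTo? s y ×-dec y ⊏? x)

  ∃-chainTo : ∀ x → ∃ (ChainTo x)
  ∃-chainTo x = go (⊏-wellFounded x)
    where
    go : ∀ {x} → Acc _⊏_ x → ∃ (ChainTo x)
    go {x} (acc rs) with any? (λ y → y ⊏? x)
    ... | yes (y , y⊏x) = let s , c = go (rs y⊏x) in suc s , step c y⊏x
    ... | no ∄y =
      0 , start λ y y⊑x → decidable-stable (y ≟ x) λ y≢x → ∄y (y , y⊑x , y≢x)

  chain-vec : ∀ {x s} → ChainTo x s → Vec (Elt P) (suc s)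
  chain-vec {x} (start _) = x ∷ []
  chain-vec {x} (step c _) = x ∷ chain-vec c

  chain-vec-descending : ∀ {x s} (c : ChainTo x s) → Linked (flip _⊏_) (chain-vec c)
  chain-vec-descending (start _) = [-]
  chain-vec-descending (step (start _) y⊏x) = y⊏x ∷ [-]
  chain-vec-descending (step c@(step _ _) y⊏x) = y⊏x ∷ chain-vec-descending c

  chainTo-length< : ∀ {x s} → ChainTo x s → s < card
  chainTo-length< {s = s} c with card ≤? s
  ... | no card≰s = ≰⇒> card≰s
  ... | yes card≤s =
    let i , j , i<j , cᵢ≡cⱼ = pigeonhole (s≤s card≤s) (lookup (chain-vec c))
        cⱼ⊏cᵢ = lookup⁺ (λ y⊏x z⊏y → ⊏-trans z⊏y y⊏x) (chain-vec-descending c) i<j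
    in contradiction cⱼ⊏cᵢ (⊏-irrefl (sym cᵢ≡cⱼ))

  ∃-rank : ∀ x → ∃ (Rank x)
  ∃-rank x =
    ∃-greatest (λ s → ChainTo? s x) card (λ _ c → <⇒≤ (chainTo-length< c)) (∃-chainTo x)

  rank : Elt P → ℕ
  rank x = proj₁ (∃-rank x)

  rank-spec : ∀ x → Rank x (rank x)
  rank-spec x = proj₂ (∃-rank x)

  rank-unique : ∀ {x r} → Rank x r → rank x ≡ r
  rank-unique {x} (c , longest) =
    ≤-antisym (longest _ (proj₁ (rank-spec x))) (proj₂ (rank-spec x) _ c)

  ⊏⇒rank< : ∀ {x y} → x ⊏ y → rank x < rank y
  ⊏⇒rank< {x} {y} x⊏y = proj₂ (rank-spec y) _ (step (proj₁ (rank-spec x)) x⊏y)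

  ⊑⇒rank≤ : ∀ {x y} → x ⊑ y → rank x ≤ rank y
  ⊑⇒rank≤ {x} {y} x⊑y with x ≟ y
  ... | yes refl = ≤-refl
  ... | no x≢y = <⇒≤ (⊏⇒rank< (x⊑y , x≢y))

  chainTo-minimal : ∀ {m s} → Minimal m → ChainTo m s → s ≡ 0
  chainTo-minimal _ (start _) = refl
  chainTo-minimal minimal (step _ (y⊑m , y≢m)) = contradiction (minimal _ y⊑m) y≢m

  minimal⇒rank≡0 : ∀ {m} → Minimal m → rank m ≡ 0
  minimal⇒rank≡0 minimal = chainTo-minimal minimal (proj₁ (rank-spec _))

  Below : ℕ → Elt P → Set
  Below l x = rank x ≤ l

  Above : ℕ → Elt P → Set
  Above k x = k ≤ rank x

  band-intro : ∀ {k l x} → Above k x → Below l x → Band k l x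
  band-intro {x = x} k≤x x≤l = (rank x , rank-spec x , k≤x) , (rank x , rank-spec x , x≤l)

  band-above : ∀ {k l x} → Band k l x → Above k x
  band-above {k} ((_ , rank-x , k≤r) , _) = subst (k ≤_) (sym (rank-unique rank-x)) k≤r

  band-below : ∀ {k l x} → Band k l x → Below l x
  band-below {l = l} (_ , (_ , rank-x , r≤l)) = subst (_≤ l) (sym (rank-unique rank-x)) r≤l

  BandSeparates : ℕ → ℕ → Set
  BandSeparates k l = ∀ {x y} → x ⊑ y → rank x < k → l < rank y
                    → ∃ λ z → x ⊑ z × z ⊑ y × Above k z × Below l z

  coverFree⇒bandSeparates : ∀ {k l} → k ≤ l
    → (∀ x y → RankLt k x → RankGt l y → x ⋖ y → ⊥) → BandSeparates k l
  coverFree⇒bandSeparates {k} {l} k≤l coverFree = go (⊏-noetherian _)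
    where
    go : ∀ {x y} → Acc (flip _⊏_) x → x ⊑ y → rank x < k → l < rank y
       → ∃ λ z → x ⊑ z × z ⊑ y × Above k z × Below l z
    go {x} {y} (acc rs) x⊑y x<k l<y
      with ∃-cover-below (x⊑y , λ { refl → <⇒≱ l<y (≤-trans (<⇒≤ x<k) k≤l) })
    ... | c , x⋖c@((x⊑c , _) , _) , c⊑y with rank c ≤? l
    ...   | no c≰l =
      ⊥-elim (coverFree x c (_ , rank-spec x , x<k) (_ , rank-spec c , ≰⇒> c≰l) x⋖c)
    ...   | yes c≤l with k ≤? rank c
    ...     | yes k≤c = c , x⊑c , c⊑y , k≤c , c≤l
    ...     | no k≰c =
      let z , c⊑z , band-z = go (rs (proj₁ x⋖c)) c⊑y (≰⇒> k≰c) l<y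
      in z , ⊑-trans x⊑c c⊑z , band-z

open Ranks using (rank; rank-spec; rank-unique; Below; Above; BandSeparates)

module _ {P Q : FinPoset} {S : Elt P → Set} {T : Elt Q → Set} (f : SubIso P S Q T) where
  private
    module P = FinPoset P
    module Q = FinPoset Q
    module P≤ = IsPartialOrder P.isPO
    module Q≤ = IsPartialOrder Q.isPO

  to-cong : ∀ {a b} → proj₁ a ≡ proj₁ b → proj₁ (to f a) ≡ proj₁ (to f b)
  to-cong {a} {b} a≡b = Q≤.antisym (Equivalence.to (mono f a b) (P≤.reflexive a≡b))
                                   (Equivalence.to (mono f b a) (P≤.reflexive (sym a≡b)))

  from-mono : ∀ {a b} → proj₁ a Q.≤ proj₁ b → proj₁ (from f a) P.≤ proj₁ (from f b)
  from-mono {a} {b} a≤b = Equivalence.from (mono f (from f a) (from f b))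
    (subst₂ Q._≤_ (sym (to-from f a)) (sym (to-from f b)) a≤b)

  from-cong : ∀ {a b} → proj₁ a ≡ proj₁ b → proj₁ (from f a) ≡ proj₁ (from f b)
  from-cong a≡b = P≤.antisym (from-mono (Q≤.reflexive a≡b)) (from-mono (Q≤.reflexive (sym a≡b)))

  inverse : SubIso Q T P S
  inverse = record
    { to = from f ; from = to f ; from-to = to-from f ; to-from = from-to f
    ; mono = λ a b → mk⇔ from-mono λ fa≤fb →
        subst₂ Q._≤_ (to-from f a) (to-from f b)
                     (Equivalence.to (mono f (from f a) (from f b)) fa≤fb) }

compose : ∀ {P Q R S T U} → SubIso P S Q T → SubIso Q T R U → SubIso P S R U
compose f g = record
  { to = to g ∘ to f
  ; from = from f ∘ from g
  ; from-to = λ a → trans (from-cong f (from-to g (to f a))) (from-to f a)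
  ; to-from = λ c → trans (to-cong g (to-from f (from g c))) (to-from g c)
  ; mono = λ a b → mk⇔ (Equivalence.to (mono g _ _) ∘ Equivalence.to (mono f a b))
                       (Equivalence.from (mono f a b) ∘ Equivalence.from (mono g _ _)) }

restrict : ∀ {P Q S T S′ T′} (f : SubIso P S Q T)
  → (∀ {x} → S′ x → S x) → (∀ {y} → T′ y → T y)
  → (∀ a → S′ (proj₁ a) → T′ (proj₁ (to f a)))
  → (∀ b → T′ (proj₁ b) → S′ (proj₁ (from f b)))
  → SubIso P S′ Q T′
restrict f sS sT fw bw = record
  { to = λ (x , p) → proj₁ (to f (x , sS p)) , fw _ p
  ; from = λ (y , q) → proj₁ (from f (y , sT q)) , bw _ q
  ; from-to = λ (x , p) → trans (from-cong f refl) (from-to f (x , sS p))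
  ; to-from = λ (y , q) → trans (to-cong f refl) (to-from f (y , sT q))
  ; mono = λ (x , p) (x′ , p′) → mono f (x , sS p) (x′ , sS p′) }

rigid-unique : ∀ {P Q S T} → Rigid P S → (f g : SubIso P S Q T)
  → ∀ a → proj₁ (to f a) ≡ proj₁ (to g a)
rigid-unique rigid f g a = begin
  proj₁ (to f a)                  ≡⟨ to-from g (to f a) ⟨
  proj₁ (to g (from g (to f a)))  ≡⟨ to-cong g (rigid (compose f (inverse g)) a) ⟩
  proj₁ (to g a)                  ∎

RankIso : (P : FinPoset) → (Elt P → Set) → (Q : FinPoset) → (Elt Q → Set) → Set
RankIso P S Q T = Σ (SubIso P S Q T) (RankPresIso P S Q T)

module _ {P Q : FinPoset} {S : Elt P → Set} {T : Elt Q → Set} where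

  rank-to : ((f , _) : RankIso P S Q T) → ∀ a → rank Q (proj₁ (to f a)) ≡ rank P (proj₁ a)
  rank-to (f , f-rank) a = rank-unique Q (f-rank a _ (rank-spec P _))

  rank-from : ((f , _) : RankIso P S Q T) → ∀ b → rank P (proj₁ (from f b)) ≡ rank Q (proj₁ b)
  rank-from (f , f-rank) b = begin
    rank P (proj₁ (from f b))           ≡⟨ rank-to (f , f-rank) (from f b) ⟨
    rank Q (proj₁ (to f (from f b)))   ≡⟨ cong (rank Q) (to-from f b) ⟩
    rank Q (proj₁ b)                   ∎

  inverseᴿ : RankIso P S Q T → RankIso Q T P S
  inverseᴿ (f , f-rank) = inverse f , λ b r rank-b →
    subst (FinPoset.Rank P _) (trans (rank-from (f , f-rank) b) (rank-unique Q rank-b)) (rank-spec P _)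

  band-to : ∀ {k l} ((f , _) : RankIso P S Q T) a
          → FinPoset.Band P k l (proj₁ a) → FinPoset.Band Q k l (proj₁ (to f a))
  band-to (_ , f-rank) a ((r , rank-r , k≤r) , (s , rank-s , s≤l)) =
    (r , f-rank a r rank-r , k≤r) , (s , f-rank a s rank-s , s≤l)

  restrictToRank : (f : RankIso P S Q T) (R : ℕ → Set)
    → (∀ {x} → R (rank P x) → S x) → (∀ {y} → R (rank Q y) → T y)
    → RankIso P (R ∘ rank P) Q (R ∘ rank Q)
  restrictToRank (f , f-rank) R sS sT =
    restrict f sS sT (λ a → subst R (sym (rank-to (f , f-rank) a)))
                     (λ b → subst R (sym (rank-from (f , f-rank) b)))
    , λ (x , p) → f-rank (x , sS p)

below-avoids : ∀ {P l m r} → FinPoset.Rank P m r → l < r → ∀ {x} → Below P l x → Without P m x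
below-avoids {P} {l} rank-m l<r x≤l refl = <⇒≱ l<r (subst (_≤ l) (rank-unique P rank-m) x≤l)

above-avoids : ∀ {P k m} → FinPoset.Minimal P m → 0 < k → ∀ {x} → Above P k x → Without P m x
above-avoids {P} {k} minimal 0<k k≤x refl =
  <⇒≱ 0<k (subst (k ≤_) (Ranks.minimal⇒rank≡0 P minimal) k≤x)

Agree : ∀ {P Q S S′ T T′} → SubIso P S Q T → SubIso P S′ Q T′ → Set
Agree {P} {S = S} {S′} f g =
  ∀ x (p : S x) (q : S′ x) → proj₁ (to f (x , p)) ≡ proj₁ (to g (x , q))

module _ {P Q : FinPoset} {k l : ℕ} where

  band-agree : Rigid P (FinPoset.Band P k l)
    → ((α , _) : RankIso P (Below P l) Q (Below Q l)) ((β , _) : RankIso P (Above P k) Q (Above Q k))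
    → Agree α β
  band-agree rigid (α , α-rank) (β , β-rank) x x≤l k≤x = begin
    proj₁ (to α (x , x≤l))  ≡⟨ to-cong α refl ⟩
    proj₁ (to αᴮ xᴮ)        ≡⟨ rigid-unique rigid αᴮ βᴮ xᴮ ⟩
    proj₁ (to βᴮ xᴮ)        ≡⟨ to-cong β refl ⟩
    proj₁ (to β (x , k≤x))  ∎
    where
    xᴮ : Σ (Elt P) (FinPoset.Band P k l)
    xᴮ = x , Ranks.band-intro P k≤x x≤l
    αᴮ βᴮ : SubIso P (FinPoset.Band P k l) Q (FinPoset.Band Q k l)
    αᴮ = restrict α (Ranks.band-below P) (Ranks.band-below Q)
                    (band-to (α , α-rank)) (band-to (inverseᴿ (α , α-rank)))
    βᴮ = restrict β (Ranks.band-above P) (Ranks.band-above Q)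
                    (band-to (β , β-rank)) (band-to (inverseᴿ (β , β-rank)))

  inverse-agree : ((α , _) : RankIso P (Below P l) Q (Below Q l)) (β : SubIso P (Above P k) Q (Above Q k))
    → Agree α β → Agree (inverse α) (inverse β)
  inverse-agree (α , α-rank) β agree y y≤l k≤y = begin
    proj₁ (from α (y , y≤l))         ≡⟨ from-to β (x , k≤x) ⟨
    proj₁ (from β (to β (x , k≤x)))  ≡⟨ from-cong β βx≡y ⟩
    proj₁ (from β (y , k≤y))         ∎
    where
    x : Elt P
    x = proj₁ (from α (y , y≤l))
    k≤x : Above P k x
    k≤x = subst (k ≤_) (sym (rank-from (α , α-rank) (y , y≤l))) k≤y
    βx≡y : proj₁ (to β (x , k≤x)) ≡ y
    βx≡y = trans (sym (agree x (proj₂ (from α (y , y≤l))) k≤x)) (to-from α (y , y≤l))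

-- Taking the bare maps rather than isomorphisms makes the map glued from
-- `inverse (inverse α)` definitionally the one glued from α.
glue : ∀ {P Q k l} → k ≤ l
  → (Σ (Elt P) (Below P l) → Σ (Elt Q) (Below Q l))
  → (Σ (Elt P) (Above P k) → Σ (Elt Q) (Above Q k))
  → Elt P → Elt Q
glue {P} {l = l} k≤l f g x with rank P x ≤? l
... | yes x≤l = proj₁ (f (x , x≤l))
... | no x≰l = proj₁ (g (x , ≤-trans k≤l (<⇒≤ (≰⇒> x≰l))))

module Glued {P Q : FinPoset} {k l : ℕ} (k≤l : k ≤ l)
  (α : SubIso P (Below P l) Q (Below Q l)) (β : SubIso P (Above P k) Q (Above Q k)) where
  private
    module P = FinPoset P
    module Q = FinPoset Q

  glued : Elt P → Elt Q
  glued = glue k≤l (to α) (to β)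

  glue-below : ∀ a → glued (proj₁ a) ≡ proj₁ (to α a)
  glue-below (x , x≤l) with rank P x ≤? l
  ... | yes _ = to-cong α refl
  ... | no x≰l = contradiction x≤l x≰l

  glue-above : Agree α β → ∀ b → glued (proj₁ b) ≡ proj₁ (to β b)
  glue-above agree (x , k≤x) with rank P x ≤? l
  ... | yes x≤l = agree x x≤l k≤x
  ... | no _ = to-cong β refl

  glue-mono-below : ∀ {x y} → x P.≤ y → Below P l y → glued x Q.≤ glued y
  glue-mono-below {x} {y} x≤y y≤l =
    subst₂ Q._≤_ (sym (glue-below (x , x≤l))) (sym (glue-below (y , y≤l)))
                 (Equivalence.to (mono α (x , x≤l) (y , y≤l)) x≤y)
    where
    x≤l : Below P l x
    x≤l = ≤-trans (Ranks.⊑⇒rank≤ P x≤y) y≤l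

  glue-mono-above : Agree α β → ∀ {x y} → x P.≤ y → Above P k x → glued x Q.≤ glued y
  glue-mono-above agree {x} {y} x≤y k≤x =
    subst₂ Q._≤_ (sym (glue-above agree (x , k≤x))) (sym (glue-above agree (y , k≤y)))
                 (Equivalence.to (mono β (x , k≤x) (y , k≤y)) x≤y)
    where
    k≤y : Above P k y
    k≤y = ≤-trans k≤x (Ranks.⊑⇒rank≤ P x≤y)

  glue-mono : Agree α β → BandSeparates P k l → ∀ {x y} → x P.≤ y → glued x Q.≤ glued y
  glue-mono agree separates {x} {y} x≤y = by-cases (rank P y ≤? l) (k ≤? rank P x)
    where
    by-cases : Dec (Below P l y) → Dec (Above P k x) → glued x Q.≤ glued y
    by-cases (yes y≤l) _ = glue-mono-below x≤y y≤l
    by-cases (no _) (yes k≤x) = glue-mono-above agree x≤y k≤x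
    by-cases (no y≰l) (no k≰x) =
      let z , x≤z , z≤y , k≤z , z≤l = separates x≤y (≰⇒> k≰x) (≰⇒> y≰l)
      in IsPartialOrder.trans Q.isPO (glue-mono-below x≤z z≤l) (glue-mono-above agree z≤y k≤z)

glue-inverse : ∀ {P Q k l} (k≤l : k ≤ l)
  (α : SubIso P (Below P l) Q (Below Q l)) (β : SubIso P (Above P k) Q (Above Q k))
  → Agree (inverse α) (inverse β)
  → ∀ x → glue k≤l (from α) (from β) (glue k≤l (to α) (to β) x) ≡ x
glue-inverse {P} {l = l} k≤l α β agree⁻¹ x with rank P x ≤? l
... | yes x≤l =
  trans (Glued.glue-below k≤l (inverse α) (inverse β) (to α (x , x≤l))) (from-to α (x , x≤l))
... | no _ =
  trans (Glued.glue-above k≤l (inverse α) (inverse β) agree⁻¹ (to β (x , _))) (from-to β (x , _))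

mk≅ : ∀ {P Q} (f : Elt P → Elt Q) (g : Elt Q → Elt P)
  → (∀ {x y} → FinPoset._≤_ P x y → FinPoset._≤_ Q (f x) (f y))
  → (∀ {x y} → FinPoset._≤_ Q x y → FinPoset._≤_ P (g x) (g y))
  → (∀ x → g (f x) ≡ x) → (∀ y → f (g y) ≡ y)
  → P ≅ Q
mk≅ {P} f g f-mono g-mono g∘f f∘g = record
  { to = λ (x , _) → f x , tt
  ; from = λ (y , _) → g y , tt
  ; from-to = λ (x , _) → g∘f x
  ; to-from = λ (y , _) → f∘g y
  ; mono = λ (x , _) (y , _) → mk⇔ f-mono λ fx≤fy →
      subst₂ (FinPoset._≤_ P) (g∘f x) (g∘f y) (g-mono fx≤fy) }

glue-≅ : ∀ {P Q k l} → k ≤ l → BandSeparates P k l → BandSeparates Q k l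
  → ((α , _) : RankIso P (Below P l) Q (Below Q l)) ((β , _) : RankIso P (Above P k) Q (Above Q k))
  → Agree α β → P ≅ Q
glue-≅ k≤l separatesP separatesQ (α , α-rank) (β , _) agree =
  mk≅ (glue k≤l (to α) (to β)) (glue k≤l (from α) (from β))
      (Glued.glue-mono k≤l α β agree separatesP)
      (Glued.glue-mono k≤l (inverse α) (inverse β) agree⁻¹ separatesQ)
      (glue-inverse k≤l α β agree⁻¹)
      (glue-inverse k≤l (inverse α) (inverse β) agree)
  where
  agree⁻¹ : Agree (inverse α) (inverse β)
  agree⁻¹ = inverse-agree (α , α-rank) β agree

proposition6p3 : (P Q : FinPoset) (k l : ℕ) → 0 < k → k < l
    → RigidSeparator P k l → RigidSeparator Q k l
    → (MP : Elt P) (MQ : Elt Q) (r : ℕ) → l < r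
    → FinPoset.Maximal P MP → FinPoset.Rank P MP r
    → FinPoset.Maximal Q MQ → FinPoset.Rank Q MQ r
    → Σ (SubIso P (Without P MP) Q (Without Q MQ))
        (RankPresIso P (Without P MP) Q (Without Q MQ))
    → (mP : Elt P) (mQ : Elt Q)
    → FinPoset.Minimal P mP → FinPoset.Minimal Q mQ
    → Σ (SubIso P (Without P mP) Q (Without Q mQ))
        (RankPresIso P (Without P mP) Q (Without Q mQ))
    → P ≅ Q
proposition6p3 P Q k l 0<k k<l (rigidP , _ , coverFreeP) (_ , _ , coverFreeQ)
               MP MQ r l<r _ rank-MP _ rank-MQ φ mP mQ minimal-mP minimal-mQ ψ =
  glue-≅ k≤l (Ranks.coverFree⇒bandSeparates P k≤l coverFreeP)
             (Ranks.coverFree⇒bandSeparates Q k≤l coverFreeQ)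
             φ≤ ψ≥ (band-agree rigidP φ≤ ψ≥)
  where
  k≤l : k ≤ l
  k≤l = <⇒≤ k<l
  φ≤ : RankIso P (Below P l) Q (Below Q l)
  φ≤ = restrictToRank φ (_≤ l) (below-avoids rank-MP l<r) (below-avoids rank-MQ l<r)
  ψ≥ : RankIso P (Above P k) Q (Above Q k)
  ψ≥ = restrictToRank ψ (k ≤_) (above-avoids minimal-mP 0<k) (above-avoids minimal-mQ 0<k)
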